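{- Let $k\ge 2$. In the game described in the context, suppose the codemaker answers every guess using the greedy strategy. Then for every sequence of guesses $x^{(1)},\dots,x^{(k-2)}\in[k]^k$ of the codebreaker, the answer set after $k-2$ rounds satisfies $|P_{k-2}|>1$.
   Context: Game: $k$ positions, codes $[k]=\{1,\dots,k\}$; the answer is known to be a permutation of $\{1,\dots,k\}$ (viewed as a string in $[k]^k$). In each round the codebreaker submits any $x\in[k]^k$ and receives feedback in $\{\checkmark,\times\}^k$, where for an answer $y$ the true feedback is $\tau_i=\checkmark$ if $x_i=y_i$ and $\times$ otherwise. The answer set $P_r$ is the set of permutations $y$ consistent with all guesses and feedbacks of rounds $1,\dots,r$; $P_0$ is the set of all permutations of $\{1,\dots,k\}$. Greedy strategy (codemaker, adaptive, not committing to an answer): in round $r$, given guess $x=(x_1,\dots,x_k)$, set $Q_0=P_{r-1}$ and for $i=1,\dots,k$ in order let $S=\{a\in Q_{i-1}: a_i=x_i\}$; if $S=Q_{i-1}$, give feedback $\tau_i=\checkmark$ and set $Q_i=Q_{i-1}$; otherwise give $\tau_i=\times$ and set $Q_i=Q_{i-1}\setminus S$. Then $P_r=Q_k$. -}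

module Defs where

open import Data.Nat using (ℕ; zero; suc)
open import Data.Fin using (Fin)
open import Data.Fin.Properties using (_≟_)
open import Data.Vec using (Vec; []; _∷_; lookup; toList)
open import Data.List using (List; []; _∷_; concatMap; map; filter; length)
open import Data.List.Relation.Unary.All using (all?)
open import Data.List.Relation.Unary.Unique.Propositional using (Unique)
import Data.List.Relation.Unary.Unique.DecPropositional as UDec
open import Relation.Nullary using (¬?)
open import Data.Fin.Base using (Fin)
open import Data.List.Base using (allFin)

-- Codes: [k] is represented by Fin k (code c+1 ↔ Fin element c).
-- A guess / candidate answer is a string in [k]^k, i.e. Vec (Fin k) k.
Code : ℕ → Set
Code k = Vec (Fin k) k

allStrings : (n m : ℕ) → List (Vec (Fin n) m)
allStrings n zero    = [] ∷ []
allStrings n (suc m) = concatMap (λ c → map (c ∷_) (allStrings n m)) (allFin n)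

P₀ : (k : ℕ) → List (Code k)
P₀ k = filter (λ v → UDec.unique? (_≟_ {k}) (toList v)) (allStrings k k)

-- One step of the greedy codemaker at position i with guess x:
-- S = {a ∈ Q : a_i = x_i}; if S = Q keep Q (feedback ✓), else Q ∖ S (feedback ×).
greedyPos : ∀ {k} → Code k → Fin k → List (Code k) → List (Code k)
greedyPos x i Q with all? (λ a → lookup a i ≟ lookup x i) Q
... | Relation.Nullary.yes _ = Q
... | Relation.Nullary.no  _ = filter (λ a → ¬? (lookup a i ≟ lookup x i)) Q

greedyRound : ∀ {k} → Code k → List (Code k) → List (Code k)
greedyRound {k} x Q = Data.List.foldl (λ Q′ i → greedyPos x i Q′) Q (allFin k)

answerSet : ∀ {k r} → Vec (Code k) r → List (Code k)
answerSet {k} xs = Data.Vec.foldl (λ _ → List (Code k)) (λ Q x → greedyRound x Q) (P₀ k) xs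

{-# OPTIONS --safe #-}
-- At each position the greedy codemaker either keeps every candidate or removes
-- exactly those that hit the guess there. So if y survives and a permutation z
-- hits each guess only at positions where y hits it too, z survives as well.
-- Take y in the final answer set. At a position i the k − 2 guesses show at most
-- k − 2 values, so some j ≠ i has y_j never guessed at i. The map i ↦ j has no
-- fixed point, hence a cycle; rotating y along that cycle yields a permutation
-- z ≠ y that hits a guess at i only where z_i = y_i, so z survives too.
module Submission where

open import Data.Nat using (ℕ; zero; suc; _+_; _≤_; _<_; _∸_; s≤s; z≤n)
open import Data.Nat.Properties using (+-suc; n<1+n; ≤-refl; m≤n⇒∃[o]m+o≡n)
open import Data.Nat.GeneralisedArithmetic using (iterate)
open import Data.Fin using (Fin; zero; suc; toℕ)
open import Data.Fin.Properties using (_≟_; pigeonhole; <-irrefl; ¬∀⟶∃¬)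
open import Data.Vec using (Vec; []; _∷_; lookup; toList; tabulate; map)
open import Data.Vec.Properties using (lookup∘tabulate)
import Data.Vec.Relation.Unary.Any as Anyᵛ
open Anyᵛ using (here; there)
open import Data.Vec.Relation.Unary.Any.Properties using (lookup-index)
import Data.Vec.Membership.Propositional as Memᵛ
import Data.Vec.Membership.DecPropositional as DecMemᵛ
open import Data.Vec.Membership.Propositional.Properties
  using (∈-toList⁺; ∈-toList⁻; ∈-lookup) renaming (∈-map⁺ to ∈ᵛ-map⁺)
open import Data.List using (List; []; _∷_; length; allFin; foldl)
import Data.List as List
open import Data.List.Relation.Unary.All using (All; []; _∷_; all?)
import Data.List.Relation.Unary.All as All
open import Data.List.Relation.Unary.All.Properties.Core using (¬All⇒Any¬)
open import Data.List.Relation.Unary.Any using (here; there)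
import Data.List.Relation.Unary.Any as Any
open import Data.List.Relation.Unary.AllPairs using (_∷_)
open import Data.List.Relation.Unary.Unique.Propositional using (Unique)
open import Data.List.Relation.Unary.Unique.Propositional.Properties using (tabulate⁺)
import Data.List.Relation.Unary.Unique.DecPropositional as UniqueDec
open import Data.List.Membership.Propositional using (_∈_; find)
open import Data.List.Membership.Propositional.Properties
  using (∈-filter⁺; ∈-filter⁻; ∈-concatMap⁺; ∈-map⁺; ∈-allFin)
open import Data.Product using (∃; ∃₂; _×_; _,_; proj₁; proj₂)
open import Data.Sum using (_⊎_; inj₁; inj₂)
open import Data.Empty using (⊥-elim)
open import Function using (_∘_; flip; id)
open import Function.Definitions using (Injective)
open import Relation.Nullary using (Dec; ¬_; yes; no; ¬?)
open import Relation.Binary.Definitions using (DecidableEquality)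
open import Relation.Binary.PropositionalEquality
open import Defs

Injection : Set → Set → Set
Injection A B = ∃ λ (g : A → B) → Injective _≡_ _≡_ g

module _ {n : ℕ} (f : Fin n → Fin n) where

  iterate-+ : ∀ x a b → iterate f x (a + b) ≡ iterate f (iterate f x a) b
  iterate-+ x zero    b = refl
  iterate-+ x (suc a) b = iterate-+ (f x) a b

  iterate-comm : ∀ x a → iterate f (f x) a ≡ f (iterate f x a)
  iterate-comm x zero    = refl
  iterate-comm x (suc a) = iterate-comm (f x) a

  Periodic : ℕ → Fin n → Set
  Periodic d v = iterate f v (suc d) ≡ v

  periodic-step : ∀ {d v} → Periodic d v → Periodic d (f v)
  periodic-step {d} {v} p = trans (iterate-comm v (suc d)) (cong f p)

periodic-point : ∀ {m} (f : Fin (suc m) → Fin (suc m)) → ∃₂ λ d v → Periodic f d v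
periodic-point {m} f
  with i , j , i<j , pᵢ≡pⱼ ← pigeonhole (n<1+n (suc m)) (iterate f zero ∘ toℕ)
  with d , 1+i+d≡j ← m≤n⇒∃[o]m+o≡n i<j
  = d , iterate f zero (toℕ i) , (begin
      iterate f (iterate f zero (toℕ i)) (suc d)  ≡⟨ iterate-+ f zero (toℕ i) (suc d) ⟨
      iterate f zero (toℕ i + suc d)              ≡⟨ cong (iterate f zero) (trans (+-suc (toℕ i) d) 1+i+d≡j) ⟩
      iterate f zero (toℕ j)                      ≡⟨ pᵢ≡pⱼ ⟨
      iterate f zero (toℕ i)                      ∎)
  where open ≡-Reasoning

-- rotate is injective because f maps the points of period dividing suc d into
-- themselves and is injective on them (iterating f another d times inverts it).
module Rotation {n : ℕ} (f : Fin n → Fin n) (d : ℕ) where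

  rotate : Fin n → Fin n
  rotate v with iterate f v (suc d) ≟ v
  ... | yes _ = f v
  ... | no  _ = v

  rotate-fixes-or-steps : ∀ v → rotate v ≡ v ⊎ rotate v ≡ f v
  rotate-fixes-or-steps v with iterate f v (suc d) ≟ v
  ... | yes _ = inj₂ refl
  ... | no  _ = inj₁ refl

  rotate-periodic : ∀ {v} → Periodic f d v → rotate v ≡ f v
  rotate-periodic {v} p with iterate f v (suc d) ≟ v
  ... | yes _  = refl
  ... | no ¬p = ⊥-elim (¬p p)

  rotate-injective : Injective _≡_ _≡_ rotate
  rotate-injective {v} {w} eq with iterate f v (suc d) ≟ v | iterate f w (suc d) ≟ w
  ... | yes pv | yes pw = trans (sym pv) (trans (cong (λ u → iterate f u d) eq) pw)
  ... | yes pv | no ¬pw = ⊥-elim (¬pw (subst (Periodic f d) eq (periodic-step f {d} pv)))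
  ... | no ¬pv | yes pw = ⊥-elim (¬pv (subst (Periodic f d) (sym eq) (periodic-step f {d} pw)))
  ... | no _   | no _   = eq

nontrivial-cycle : ∀ {m} (f : Fin (suc m) → Fin (suc m)) → (∀ i → f i ≢ i) →
  ∃ λ ((σ , _) : Injection (Fin (suc m)) (Fin (suc m))) →
    (∀ i → σ i ≡ i ⊎ σ i ≡ f i) × ∃ λ i → σ i ≢ i
nontrivial-cycle f f-fpf with d , v , v-periodic ← periodic-point f =
  (rotate , rotate-injective) , rotate-fixes-or-steps ,
  v , λ σv≡v → f-fpf v (trans (sym (rotate-periodic v-periodic)) σv≡v)
  where open Rotation f d

open Memᵛ using () renaming (_∈_ to _∈ᵛ_; _∉_ to _∉ᵛ_)

module _ {A : Set} (_≟ᴬ_ : DecidableEquality A) where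
  open DecMemᵛ _≟ᴬ_ using (_∈?_)

  injection-avoids : ∀ {k r} ((g , _) : Injection (Fin k) A) (v : Vec A r) → r < k →
                     ∃ λ j → g j ∉ᵛ v
  injection-avoids (g , g-inj) v r<k = ¬∀⟶∃¬ _ _ (λ j → g j ∈? v) not-all-in
    where
    not-all-in : ¬ (∀ j → g j ∈ᵛ v)
    not-all-in g∈v with i , j , i<j , eq ← pigeonhole r<k (Anyᵛ.index ∘ g∈v) =
      <-irrefl (g-inj (trans (lookup-index (g∈v i))
                      (trans (cong (lookup v) eq) (sym (lookup-index (g∈v j)))))) i<j

distinct-members⇒1<length : ∀ {A : Set} {a b : A} {L : List A} →
                            a ∈ L → b ∈ L → a ≢ b → 1 < length L
distinct-members⇒1<length (here refl) (here refl)            a≢b = ⊥-elim (a≢b refl)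
distinct-members⇒1<length (here _)    (there {xs = _ ∷ _} _) _   = s≤s (s≤s z≤n)
distinct-members⇒1<length (there {xs = _ ∷ _} _) _           _   = s≤s (s≤s z≤n)

allStrings-complete : ∀ n m (v : Vec (Fin n) m) → v ∈ allStrings n m
allStrings-complete n zero    []      = here refl
allStrings-complete n (suc m) (c ∷ v) =
  ∈-concatMap⁺ (λ c → List.map (c ∷_) (allStrings n m))
    (Any.map (λ { refl → ∈-map⁺ (c ∷_) (allStrings-complete n m v) }) (∈-allFin c))

toList-tabulate : ∀ {A : Set} {n} (g : Fin n → A) → toList (tabulate g) ≡ List.tabulate g
toList-tabulate {n = zero}  g = refl
toList-tabulate {n = suc n} g = cong (g zero ∷_) (toList-tabulate (g ∘ suc))

unique⇒lookup-injective : ∀ {A : Set} {n} (v : Vec A n) → Unique (toList v) →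
                          Injective _≡_ _≡_ (lookup v)
unique⇒lookup-injective (a ∷ v) (a∉v ∷ u) {zero}  {zero}  eq = refl
unique⇒lookup-injective (a ∷ v) (a∉v ∷ u) {zero}  {suc j} eq =
  ⊥-elim (All.lookup a∉v (∈-toList⁺ (∈-lookup j v)) eq)
unique⇒lookup-injective (a ∷ v) (a∉v ∷ u) {suc i} {zero}  eq =
  ⊥-elim (All.lookup a∉v (∈-toList⁺ (∈-lookup i v)) (sym eq))
unique⇒lookup-injective (a ∷ v) (a∉v ∷ u) {suc i} {suc j} eq =
  cong suc (unique⇒lookup-injective v u eq)

module _ {k : ℕ} where

  unique? : (v : Code k) → Dec (Unique (toList v))
  unique? v = UniqueDec.unique? (_≟_ {k}) (toList v)

  tabulate∈P₀ : ((g , _) : Injection (Fin k) (Fin k)) → tabulate g ∈ P₀ k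
  tabulate∈P₀ (g , g-inj) =
    ∈-filter⁺ unique? (allStrings-complete k k (tabulate g))
      (subst Unique (sym (toList-tabulate g)) (tabulate⁺ g-inj))

  P₀-lookup-injective : ∀ {y} → y ∈ P₀ k → Injective _≡_ _≡_ (lookup y)
  P₀-lookup-injective {y} y∈P₀ =
    unique⇒lookup-injective y (proj₂ (∈-filter⁻ unique? {xs = allStrings k k} y∈P₀))

module _ {A B : Set} (step : List A → B → List A)
         (step-⊆ : ∀ {Q b a} → a ∈ step Q b → a ∈ Q) where

  foldl-⊆ : ∀ bs {Q a} → a ∈ foldl step Q bs → a ∈ Q
  foldl-⊆ []       a∈ = a∈
  foldl-⊆ (b ∷ bs) a∈ = step-⊆ (foldl-⊆ bs a∈)

  foldl-nonempty : (∀ {Q b a} → a ∈ Q → ∃ (_∈ step Q b)) →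
                   ∀ bs {Q a} → a ∈ Q → ∃ (_∈ foldl step Q bs)
  foldl-nonempty step-nonempty []       a∈ = _ , a∈
  foldl-nonempty step-nonempty (b ∷ bs) a∈ = foldl-nonempty step-nonempty bs (proj₂ (step-nonempty a∈))

  foldl-retains : ∀ {y z} bs → All (λ b → ∀ {Q} → z ∈ Q → y ∈ step Q b → z ∈ step Q b) bs →
                  ∀ {Q} → z ∈ Q → y ∈ foldl step Q bs → z ∈ foldl step Q bs
  foldl-retains []       []             z∈ y∈ = z∈
  foldl-retains (b ∷ bs) (retains ∷ rs) z∈ y∈ = foldl-retains bs rs (retains z∈ (foldl-⊆ bs y∈)) y∈

foldlᵛ≡foldl-toList : ∀ {A B : Set} (f : B → A → B) {r} e (xs : Vec A r) →
                      Data.Vec.foldl (λ _ → B) f e xs ≡ foldl f e (toList xs)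
foldlᵛ≡foldl-toList f e []       = refl
foldlᵛ≡foldl-toList f e (x ∷ xs) = foldlᵛ≡foldl-toList f (f e x) xs

_≼[_]_ : ∀ {k} → Code k → Code k → Code k → Set
z ≼[ x ] y = ∀ i → lookup z i ≡ lookup x i → lookup y i ≡ lookup x i

module _ {k : ℕ} (x : Code k) (i : Fin k) where

  greedyPos-⊆ : ∀ {Q a} → a ∈ greedyPos x i Q → a ∈ Q
  greedyPos-⊆ {Q} a∈ with all? (λ a → lookup a i ≟ lookup x i) Q
  ... | yes _ = a∈
  ... | no  _ = proj₁ (∈-filter⁻ (λ a → ¬? (lookup a i ≟ lookup x i)) {xs = Q} a∈)

  greedyPos-nonempty : ∀ {Q a} → a ∈ Q → ∃ (_∈ greedyPos x i Q)
  greedyPos-nonempty {Q} a∈ with all? (λ a → lookup a i ≟ lookup x i) Q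
  ... | yes _ = _ , a∈
  ... | no ¬all with b , b∈ , b-miss ← find (¬All⇒Any¬ (λ a → lookup a i ≟ lookup x i) Q ¬all) =
    b , ∈-filter⁺ (λ a → ¬? (lookup a i ≟ lookup x i)) b∈ b-miss

  -- When Q shrinks it keeps exactly the codes missing x at i, and y is one of them.
  greedyPos-retains : ∀ {Q y z} → (lookup z i ≡ lookup x i → lookup y i ≡ lookup x i) →
                      z ∈ Q → y ∈ greedyPos x i Q → z ∈ greedyPos x i Q
  greedyPos-retains {Q} z-hit⇒y-hit z∈ y∈ with all? (λ a → lookup a i ≟ lookup x i) Q
  ... | yes _ = z∈
  ... | no  _ = ∈-filter⁺ (λ a → ¬? (lookup a i ≟ lookup x i)) z∈
                  (proj₂ (∈-filter⁻ (λ a → ¬? (lookup a i ≟ lookup x i)) {xs = Q} y∈) ∘ z-hit⇒y-hit)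

module _ {k : ℕ} where

  round : List (Code k) → Code k → List (Code k)
  round = flip greedyRound

  round-⊆ : ∀ {Q x a} → a ∈ round Q x → a ∈ Q
  round-⊆ {x = x} = foldl-⊆ (λ Q i → greedyPos x i Q) (greedyPos-⊆ x _) (allFin k)

  round-nonempty : ∀ {Q x a} → a ∈ Q → ∃ (_∈ round Q x)
  round-nonempty {x = x} =
    foldl-nonempty (λ Q i → greedyPos x i Q) (greedyPos-⊆ x _) (greedyPos-nonempty x _) (allFin k)

  round-retains : ∀ {x y z} → z ≼[ x ] y → ∀ {Q} → z ∈ Q → y ∈ round Q x → z ∈ round Q x
  round-retains {x} z≼y =
    foldl-retains (λ Q i → greedyPos x i Q) (greedyPos-⊆ x _) (allFin k)
      (All.universal (λ i {Q} → greedyPos-retains x i {Q} (z≼y i)) (allFin k))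

module _ {k r : ℕ} (xs : Vec (Code k) r) where

  answerSet-⊆ : ∀ {a} → a ∈ answerSet xs → a ∈ P₀ k
  answerSet-⊆ a∈ = foldl-⊆ round round-⊆ (toList xs) (subst (_ ∈_) (foldlᵛ≡foldl-toList round (P₀ k) xs) a∈)

  answerSet-nonempty : ∀ {a} → a ∈ P₀ k → ∃ (_∈ answerSet xs)
  answerSet-nonempty a∈ =
    subst (λ P → ∃ (_∈ P)) (sym (foldlᵛ≡foldl-toList round (P₀ k) xs))
      (foldl-nonempty round round-⊆ round-nonempty (toList xs) a∈)

  answerSet-retains : ∀ {y z} → All (z ≼[_] y) (toList xs) →
                      z ∈ P₀ k → y ∈ answerSet xs → z ∈ answerSet xs
  answerSet-retains z≼y z∈ y∈ =
    subst (_ ∈_) (sym (foldlᵛ≡foldl-toList round (P₀ k) xs))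
      (foldl-retains round round-⊆ (toList xs) (All.map (λ z≼ᵢy {Q} → round-retains z≼ᵢy {Q}) z≼y) z∈
        (subst (_ ∈_) (foldlᵛ≡foldl-toList round (P₀ k) xs) y∈))

reindex-≼ : ∀ {k} (y x : Code k) (σ f : Fin k → Fin k) → (∀ i → lookup y (f i) ≢ lookup x i) →
            (∀ i → σ i ≡ i ⊎ σ i ≡ f i) → tabulate (lookup y ∘ σ) ≼[ x ] y
reindex-≼ y x σ f f-misses fixes-or-steps i zᵢ≡xᵢ
  with yσᵢ≡xᵢ ← trans (sym (lookup∘tabulate (lookup y ∘ σ) i)) zᵢ≡xᵢ | fixes-or-steps i
... | inj₁ σi≡i = subst (λ j → lookup y j ≡ lookup x i) σi≡i yσᵢ≡xᵢ
... | inj₂ σi≡fi = ⊥-elim (f-misses i (subst (λ j → lookup y j ≡ lookup x i) σi≡fi yσᵢ≡xᵢ))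

unguessed-position : ∀ {k r} (y : Code k) → Injective _≡_ _≡_ (lookup y) →
                     (xs : Vec (Code k) r) → suc r < k →
                     ∀ i → ∃ λ j → j ≢ i × (∀ {x} → x ∈ toList xs → lookup y j ≢ lookup x i)
unguessed-position y y-inj xs r+1<k i
  with j , yⱼ∉ ← injection-avoids _≟_ (lookup y , y-inj) (lookup y i ∷ map (λ x → lookup x i) xs) r+1<k
  = j , (λ j≡i → yⱼ∉ (here (cong (lookup y) j≡i))) ,
    λ x∈ yⱼ≡xᵢ → yⱼ∉ (there (subst (_∈ᵛ map (λ x → lookup x i) xs) (sym yⱼ≡xᵢ)
                                   (∈ᵛ-map⁺ (λ x → lookup x i) (∈-toList⁻ x∈))))

proposition2 : (k : ℕ) → 2 ≤ k → (xs : Vec (Code k) (k ∸ 2)) → 1 < length (answerSet xs)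
proposition2 (suc (suc m)) (s≤s (s≤s z≤n)) xs
  with y , y∈ ← answerSet-nonempty xs (tabulate∈P₀ (id , id))
  with y-inj ← P₀-lookup-injective (answerSet-⊆ xs y∈)
  with escape ← unguessed-position y y-inj xs ≤-refl
  with (σ , σ-inj) , fixes-or-escapes , i₀ , σi₀≢i₀
         ← nontrivial-cycle (proj₁ ∘ escape) (proj₁ ∘ proj₂ ∘ escape)
  = distinct-members⇒1<length y∈ z∈ y≢z
  where
  z : Code (suc (suc m))
  z = tabulate (lookup y ∘ σ)

  z≼y : All (z ≼[_] y) (toList xs)
  z≼y = All.tabulate λ {x} x∈ →
    reindex-≼ y x σ (proj₁ ∘ escape) (λ i → proj₂ (proj₂ (escape i)) x∈) fixes-or-escapes

  z∈ : z ∈ answerSet xs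
  z∈ = answerSet-retains xs z≼y (tabulate∈P₀ (lookup y ∘ σ , σ-inj ∘ y-inj)) y∈

  y≢z : y ≢ z
  y≢z y≡z = σi₀≢i₀ (sym (y-inj (trans (cong (λ v → lookup v i₀) y≡z) (lookup∘tabulate (lookup y ∘ σ) i₀))))
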